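{- Let $C\subseteq\mathbb{F}_2^n$ be a binary code containing the zero vector and let $C^*\subseteq\mathbb{F}_2^{n+1}$ be its extension by a parity check bit. Suppose $C^*$ is completely regular with minimum distance $d^*=2e+2\ge 4$. For $w$ let $A_w$ denote the number of codewords of weight $w$ in $C$ (equally, in $C_{[i]}$ for any $i$). Then for every odd $w\ge 2e+1$, $$(n-w)A_w=(w+1)A_{w+1}.$$
   Context: For $v\in\mathbb{F}_2^n$ and $i\in\{1,\dots,n\}$, $\tau_i(v)=(v_1,\dots,v_{i-1},p(v),v_{i+1},\dots,v_n)$ with $p(v)=\sum_j v_j\pmod 2$, and $C_{[i]}=\{\tau_i(x):x\in C\}$. Codes are assumed distance invariant. A code $D\subseteq\mathbb{F}_2^N$ is completely regular if for every $x\in\mathbb{F}_2^N$ the numbers $B_{x,j}=|\{v\in D: d(x,v)=j\}|$, $j=0,\dots,N$, depend only on $j$ and the distance $d(x,D)$. -}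

module Defs where

open import Data.Bool using (Bool; true; false; _∧_; _xor_; not; if_then_else_; T)
open import Data.Nat using (ℕ; zero; suc; _+_; _⊓_; _≡ᵇ_; _≤_)
open import Data.List using (List; []; _∷_; map; _++_; foldr)
open import Data.Vec using (Vec; []; _∷_; init; last)
open import Data.Product using (Σ; _×_; ∃; ∃-syntax; _,_)
open import Relation.Binary.PropositionalEquality using (_≡_; _≢_)

-- Binary words of length n (elements of F_2^n); Bool = F_2 with xor as addition.
Word : ℕ → Set
Word n = Vec Bool n

Code : ℕ → Set
Code n = Word n → Bool

allWords : (n : ℕ) → List (Word n)
allWords zero = [] ∷ []
allWords (suc n) = map (false ∷_) (allWords n) ++ map (true ∷_) (allWords n)

count : {n : ℕ} → (Word n → Bool) → ℕ
count {n} p = foldr (λ x acc → if p x then suc acc else acc) 0 (allWords n)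

weight : {n : ℕ} → Word n → ℕ
weight [] = 0
weight (true ∷ v) = suc (weight v)
weight (false ∷ v) = weight v

dist : {n : ℕ} → Word n → Word n → ℕ
dist [] [] = 0
dist (a ∷ u) (b ∷ v) = if a xor b then suc (dist u v) else dist u v

parity : {n : ℕ} → Word n → Bool
parity [] = false
parity (a ∷ v) = a xor parity v

-- Extension C* ⊆ F_2^(n+1) of C by an overall parity check bit (appended last):
-- y ∈ C* iff y = (x, p(x)) with x ∈ C.
extend : {n : ℕ} → Code n → Code (suc n)
extend C y = C (init y) ∧ not (last y xor parity (init y))

B : {N : ℕ} → Code N → Word N → ℕ → ℕ
B D x j = count (λ v → D v ∧ (dist x v ≡ᵇ j))

-- d(x,D) = min_{v ∈ D} d(x,v)  (default N if D is empty; distances are ≤ N).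
distToCode : {N : ℕ} → Code N → Word N → ℕ
distToCode {N} D x = foldr (λ v acc → if D v then dist x v ⊓ acc else acc) N (allWords N)

CompletelyRegular : {N : ℕ} → Code N → Set
CompletelyRegular {N} D =
  (x y : Word N) → distToCode D x ≡ distToCode D y → (j : ℕ) → B D x j ≡ B D y j

MinDistance : {N : ℕ} → Code N → ℕ → Set
MinDistance {N} D δ =
  ((u v : Word N) → T (D u) → T (D v) → u ≢ v → δ ≤ dist u v)
  × (∃[ u ] ∃[ v ] (T (D u) × T (D v) × u ≢ v × dist u v ≡ δ))

A : {n : ℕ} → Code n → ℕ → ℕ
A C w = count (λ x → C x ∧ (weight x ≡ᵇ w))

DistanceInvariant : {n : ℕ} → Code n → Set
DistanceInvariant C = ∀ x → T (C x) → ∀ w → B C x w ≡ A C w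

-- Write C* for the extended code and e₁, …, eₙ₊₁ for the unit vectors of F₂ⁿ⁺¹.  Since 0 ∈ C*
-- and all words of C* have even weight, every eᵢ lies at distance 1 from C*, so complete
-- regularity makes B_{eᵢ,k} independent of i.  Summing over i and counting, for each codeword v,
-- the unit vectors at distance m+1 from it gives, with A* the weight distribution of C*,
--   (n+1) · B_{eₙ₊₁,m+1} = (m+2) · A*_{m+2} + (n+1−m) · A*_m.
-- Splitting the words of C* by their last bit expresses both B_{eₙ₊₁,·} and A* through A; for odd h
--   (n+1)(A_{h+1} + A_{h+2}) = (h+3)(A_{h+3} + A_{h+2}) + (n−h)(A_{h+1} + A_h),
-- so (n−h) A_h = (h+1) A_{h+1} propagates from h to h+2.  It starts at h = 2e−1, where both sides
-- vanish because C* has no nonzero word of weight below 2e+2.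

module Submission where

open import Defs
open import Data.Bool using (Bool; true; false; _∧_; _xor_; not; if_then_else_; T)
open import Data.Bool.Properties using (not-involutive; xor-identityʳ; xor-assoc; xor-same; ∧-identityʳ; ∧-zeroʳ)
open import Data.Empty using (⊥-elim)
open import Data.Fin using (Fin; zero; suc; fromℕ)
open import Data.List using (List; []; _∷_; map; _++_; foldr)
open import Data.List.Properties using (foldr-++; foldr-map)
open import Data.List.Membership.Propositional using (_∈_)
open import Data.List.Membership.Propositional.Properties using (∈-++⁺ˡ; ∈-++⁺ʳ; ∈-map⁺)
open import Data.List.Relation.Unary.Any using (here; there)
open import Data.Nat using (ℕ; zero; suc; _+_; _*_; _∸_; _≤_; _<_; _⊓_; _≡ᵇ_; _%_; z≤n; s≤s; _≤′_; ≤′-refl; ≤′-step; _≤?_)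
open import Data.Nat.DivMod using (_/_; m≡m%n+[m/n]*n)
open import Data.Nat.Properties
open import Algebra.Properties.CommutativeSemigroup +-commutativeSemigroup using (interchange; x∙yz≈y∙xz)
open import Algebra.Properties.CommutativeSemigroup *-commutativeSemigroup using () renaming (x∙yz≈y∙xz to m*[n*o]≡n*[m*o])
open import Data.Product using (_,_; proj₂)
open import Data.Vec using ([]; _∷_; init; last; replicate; _∷ʳ_; initLast)
open import Data.Vec.Properties using (init-∷ʳ; last-∷ʳ)
open import Algebra.Properties.Semiring.Sum +-*-semiring using (sum-syntax; ∑-distrib-+; *-distribˡ-sum; sum-cong-≗; sum-replicate-zero)
open import Relation.Binary.PropositionalEquality
open import Relation.Nullary using (yes; no)

-- Indicators and sums over F₂ⁿ

𝟙 : Bool → ℕ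
𝟙 true = 1
𝟙 false = 0

𝟙≤1 : ∀ b → 𝟙 b ≤ 1
𝟙≤1 true = ≤-refl
𝟙≤1 false = z≤n

𝟙-∧ : ∀ a b → 𝟙 (a ∧ b) ≡ 𝟙 a * 𝟙 b
𝟙-∧ true true = refl
𝟙-∧ true false = refl
𝟙-∧ false b = refl

*-𝟙-≡ᵇ : (g : ℕ → ℕ) (a b : ℕ) → g a * 𝟙 (a ≡ᵇ b) ≡ g b * 𝟙 (a ≡ᵇ b)
*-𝟙-≡ᵇ g a b with a ≡ᵇ b in eq
... | true = cong (λ x → g x * 1) (≡ᵇ⇒≡ a b (subst T (sym eq) _))
... | false = trans (*-zeroʳ (g a)) (sym (*-zeroʳ (g b)))

Σ-word : (n : ℕ) → (Word n → ℕ) → ℕ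
Σ-word zero f = f []
Σ-word (suc n) f = Σ-word n (λ v → f (false ∷ v)) + Σ-word n (λ v → f (true ∷ v))

Σ-word-cong : ∀ n {f g : Word n → ℕ} → (∀ v → f v ≡ g v) → Σ-word n f ≡ Σ-word n g
Σ-word-cong zero f≗g = f≗g []
Σ-word-cong (suc n) f≗g =
  cong₂ _+_ (Σ-word-cong n (λ v → f≗g (false ∷ v))) (Σ-word-cong n (λ v → f≗g (true ∷ v)))

Σ-word-zero : ∀ n {f : Word n → ℕ} → (∀ v → f v ≡ 0) → Σ-word n f ≡ 0
Σ-word-zero zero f≗0 = f≗0 []
Σ-word-zero (suc n) f≗0 =
  cong₂ _+_ (Σ-word-zero n (λ v → f≗0 (false ∷ v))) (Σ-word-zero n (λ v → f≗0 (true ∷ v)))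

Σ-word-+ : ∀ n (f g : Word n → ℕ) → Σ-word n (λ v → f v + g v) ≡ Σ-word n f + Σ-word n g
Σ-word-+ zero f g = refl
Σ-word-+ (suc n) f g =
  trans (cong₂ _+_ (Σ-word-+ n (λ v → f (false ∷ v)) (λ v → g (false ∷ v)))
                   (Σ-word-+ n (λ v → f (true ∷ v)) (λ v → g (true ∷ v))))
        (interchange (Σ-word n (λ v → f (false ∷ v))) (Σ-word n (λ v → g (false ∷ v))) _ _)

Σ-word-*ˡ : ∀ n c (f : Word n → ℕ) → Σ-word n (λ v → c * f v) ≡ c * Σ-word n f
Σ-word-*ˡ zero c f = refl
Σ-word-*ˡ (suc n) c f =
  trans (cong₂ _+_ (Σ-word-*ˡ n c _) (Σ-word-*ˡ n c _)) (sym (*-distribˡ-+ c _ _))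

Σ-word-∷ʳ : ∀ n (f : Word (suc n) → ℕ) →
  Σ-word (suc n) f ≡ Σ-word n (λ v → f (v ∷ʳ false)) + Σ-word n (λ v → f (v ∷ʳ true))
Σ-word-∷ʳ zero f = refl
Σ-word-∷ʳ (suc n) f =
  trans (cong₂ _+_ (Σ-word-∷ʳ n (λ v → f (false ∷ v))) (Σ-word-∷ʳ n (λ v → f (true ∷ v))))
        (interchange (Σ-word n (λ v → f (false ∷ (v ∷ʳ false)))) (Σ-word n (λ v → f (false ∷ (v ∷ʳ true)))) _ _)

∑-Σ-word-comm : ∀ N n (f : Fin N → Word n → ℕ) →
  ∑[ i < N ] Σ-word n (f i) ≡ Σ-word n (λ v → ∑[ i < N ] f i v)
∑-Σ-word-comm N zero f = refl
∑-Σ-word-comm N (suc n) f =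
  trans (∑-distrib-+ (λ i → Σ-word n (λ v → f i (false ∷ v))) (λ i → Σ-word n (λ v → f i (true ∷ v))))
  (cong₂ _+_ (∑-Σ-word-comm N n (λ i v → f i (false ∷ v))) (∑-Σ-word-comm N n (λ i v → f i (true ∷ v))))

∑-const : ∀ N c → ∑[ i < N ] c ≡ N * c
∑-const zero c = refl
∑-const (suc N) c = cong (c +_) (∑-const N c)

count-fold : ∀ n (p : Word n → Bool) k →
  foldr (λ x acc → if p x then suc acc else acc) k (allWords n) ≡ Σ-word n (λ v → 𝟙 (p v)) + k
count-fold zero p k with p []
... | true = refl
... | false = refl
count-fold (suc n) p k = begin
  foldr step k (map (false ∷_) (allWords n) ++ map (true ∷_) (allWords n))
    ≡⟨ foldr-++ step k (map (false ∷_) (allWords n)) _ ⟩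
  foldr step (foldr step k (map (true ∷_) (allWords n))) (map (false ∷_) (allWords n))
    ≡⟨ cong (λ k′ → foldr step k′ (map (false ∷_) (allWords n))) (foldr-map step (true ∷_) k (allWords n)) ⟩
  foldr step (foldr (λ x → step (true ∷ x)) k (allWords n)) (map (false ∷_) (allWords n))
    ≡⟨ foldr-map step (false ∷_) _ (allWords n) ⟩
  foldr (λ x → step (false ∷ x)) (foldr (λ x → step (true ∷ x)) k (allWords n)) (allWords n)
    ≡⟨ count-fold n (λ v → p (false ∷ v)) _ ⟩
  Σf + foldr (λ x → step (true ∷ x)) k (allWords n)
    ≡⟨ cong (Σf +_) (count-fold n (λ v → p (true ∷ v)) k) ⟩
  Σf + (Σt + k)
    ≡⟨ +-assoc Σf Σt k ⟨
  Σf + Σt + k ∎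
  where
  open ≡-Reasoning
  step : Word (suc n) → ℕ → ℕ
  step x acc = if p x then suc acc else acc
  Σf = Σ-word n (λ v → 𝟙 (p (false ∷ v)))
  Σt = Σ-word n (λ v → 𝟙 (p (true ∷ v)))

count≡Σ-word : ∀ {n} (p : Word n → Bool) → count p ≡ Σ-word n (λ v → 𝟙 (p v))
count≡Σ-word {n} p = trans (count-fold n p 0) (+-identityʳ _)

count-cong : ∀ {n} {p q : Word n → Bool} → (∀ v → p v ≡ q v) → count p ≡ count q
count-cong {n} {p} {q} p≗q =
  trans (count≡Σ-word p) (trans (Σ-word-cong n (λ v → cong 𝟙 (p≗q v))) (sym (count≡Σ-word q)))

count-∷ʳ : ∀ {n} (p : Word (suc n) → Bool) →
  count p ≡ count (λ x → p (x ∷ʳ false)) + count (λ x → p (x ∷ʳ true))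
count-∷ʳ {n} p = begin
  count p
    ≡⟨ count≡Σ-word p ⟩
  Σ-word (suc n) (λ v → 𝟙 (p v))
    ≡⟨ Σ-word-∷ʳ n (λ v → 𝟙 (p v)) ⟩
  Σ-word n (λ x → 𝟙 (p (x ∷ʳ false))) + Σ-word n (λ x → 𝟙 (p (x ∷ʳ true)))
    ≡⟨ cong₂ _+_ (count≡Σ-word (λ x → p (x ∷ʳ false))) (count≡Σ-word (λ x → p (x ∷ʳ true))) ⟨
  count (λ x → p (x ∷ʳ false)) + count (λ x → p (x ∷ʳ true))
    ∎
  where open ≡-Reasoning

A-weighted : ∀ {n} (C : Code n) (g : ℕ → ℕ) (k : ℕ) →
  Σ-word n (λ v → 𝟙 (C v) * (g (weight v) * 𝟙 (weight v ≡ᵇ k))) ≡ g k * A C k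
A-weighted {n} C g k = begin
  Σ-word n (λ v → 𝟙 (C v) * (g (weight v) * 𝟙 (weight v ≡ᵇ k)))  ≡⟨ Σ-word-cong n pointwise ⟩
  Σ-word n (λ v → g k * 𝟙 (C v ∧ (weight v ≡ᵇ k)))               ≡⟨ Σ-word-*ˡ n (g k) _ ⟩
  g k * Σ-word n (λ v → 𝟙 (C v ∧ (weight v ≡ᵇ k)))               ≡⟨ cong (g k *_) (count≡Σ-word {n} _) ⟨
  g k * A C k                                                     ∎
  where
  open ≡-Reasoning
  pointwise : ∀ v → 𝟙 (C v) * (g (weight v) * 𝟙 (weight v ≡ᵇ k)) ≡ g k * 𝟙 (C v ∧ (weight v ≡ᵇ k))
  pointwise v = begin
    𝟙 (C v) * (g (weight v) * 𝟙 (weight v ≡ᵇ k)) ≡⟨ cong (𝟙 (C v) *_) (*-𝟙-≡ᵇ g (weight v) k) ⟩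
    𝟙 (C v) * (g k * 𝟙 (weight v ≡ᵇ k))          ≡⟨ m*[n*o]≡n*[m*o] (𝟙 (C v)) (g k) _ ⟩
    g k * (𝟙 (C v) * 𝟙 (weight v ≡ᵇ k))          ≡⟨ cong (g k *_) (𝟙-∧ (C v) _) ⟨
    g k * 𝟙 (C v ∧ (weight v ≡ᵇ k))              ∎

A≡0 : ∀ {n} (C : Code n) (k : ℕ) → (∀ x → T (C x) → weight x ≢ k) → A C k ≡ 0
A≡0 {n} C k no-codeword = trans (count≡Σ-word (λ x → C x ∧ (weight x ≡ᵇ k))) (Σ-word-zero n absent)
  where
  absent : ∀ x → 𝟙 (C x ∧ (weight x ≡ᵇ k)) ≡ 0
  absent x with C x in Cx | weight x ≡ᵇ k in wx
  ... | false | _ = refl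
  ... | true | false = refl
  ... | true | true = ⊥-elim (no-codeword x (subst T (sym Cx) _) (≡ᵇ⇒≡ (weight x) k (subst T (sym wx) _)))

zeros : ∀ {n} → Word n → ℕ
zeros [] = 0
zeros (true ∷ v) = zeros v
zeros (false ∷ v) = suc (zeros v)

weight+zeros : ∀ {n} (v : Word n) → weight v + zeros v ≡ n
weight+zeros [] = refl
weight+zeros (true ∷ v) = cong suc (weight+zeros v)
weight+zeros (false ∷ v) = trans (+-suc (weight v) (zeros v)) (cong suc (weight+zeros v))

zeros≡∸weight : ∀ {n} (v : Word n) → zeros v ≡ n ∸ weight v
zeros≡∸weight {n} v = trans (sym (m+n∸m≡n (weight v) (zeros v))) (cong (_∸ weight v) (weight+zeros v))

weight≤length : ∀ {n} (v : Word n) → weight v ≤ n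
weight≤length v = subst (weight v ≤_) (weight+zeros v) (m≤m+n (weight v) (zeros v))

weight-replicate-false : ∀ n → weight (replicate n false) ≡ 0
weight-replicate-false zero = refl
weight-replicate-false (suc n) = weight-replicate-false n

replicate-∷ʳ : ∀ n → replicate n false ∷ʳ false ≡ replicate (suc n) false
replicate-∷ʳ zero = refl
replicate-∷ʳ (suc n) = cong (false ∷_) (replicate-∷ʳ n)

dist-0ˡ : ∀ {n} (v : Word n) → dist (replicate n false) v ≡ weight v
dist-0ˡ [] = refl
dist-0ˡ (true ∷ v) = cong suc (dist-0ˡ v)
dist-0ˡ (false ∷ v) = dist-0ˡ v

dist-0-0 : ∀ n → dist (replicate n false) (replicate n false) ≡ 0
dist-0-0 n = trans (dist-0ˡ (replicate n false)) (weight-replicate-false n)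

dist≡0⇒≡ : ∀ {n} (u v : Word n) → dist u v ≡ 0 → u ≡ v
dist≡0⇒≡ [] [] _ = refl
dist≡0⇒≡ (true ∷ u) (true ∷ v) d≡0 = cong (true ∷_) (dist≡0⇒≡ u v d≡0)
dist≡0⇒≡ (false ∷ u) (false ∷ v) d≡0 = cong (false ∷_) (dist≡0⇒≡ u v d≡0)

weight-∷ʳ : ∀ {n} (v : Word n) b → weight (v ∷ʳ b) ≡ 𝟙 b + weight v
weight-∷ʳ [] true = refl
weight-∷ʳ [] false = refl
weight-∷ʳ (true ∷ v) b = trans (cong suc (weight-∷ʳ v b)) (sym (+-suc (𝟙 b) (weight v)))
weight-∷ʳ (false ∷ v) b = weight-∷ʳ v b

dist-∷ʳ : ∀ {n} (u v : Word n) a b → dist (u ∷ʳ a) (v ∷ʳ b) ≡ 𝟙 (a xor b) + dist u v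
dist-∷ʳ [] [] a b with a xor b
... | true = refl
... | false = refl
dist-∷ʳ (x ∷ u) (y ∷ v) a b with x xor y
... | true = trans (cong suc (dist-∷ʳ u v a b)) (sym (+-suc (𝟙 (a xor b)) (dist u v)))
... | false = dist-∷ʳ u v a b

parity-∷ʳ : ∀ {n} (v : Word n) b → parity (v ∷ʳ b) ≡ parity v xor b
parity-∷ʳ [] b = xor-identityʳ b
parity-∷ʳ (a ∷ v) b = trans (cong (a xor_) (parity-∷ʳ v b)) (sym (xor-assoc a (parity v) b))

isOdd : ℕ → Bool
isOdd zero = false
isOdd (suc k) = not (isOdd k)

isOdd-2k+1 : ∀ k → isOdd (suc (k * 2)) ≡ true
isOdd-2k+1 zero = refl
isOdd-2k+1 (suc k) = trans (not-involutive _) (isOdd-2k+1 k)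

parity≡isOdd-weight : ∀ {n} (v : Word n) → parity v ≡ isOdd (weight v)
parity≡isOdd-weight [] = refl
parity≡isOdd-weight (true ∷ v) = cong not (parity≡isOdd-weight v)
parity≡isOdd-weight (false ∷ v) = parity≡isOdd-weight v

parity-0 : ∀ n → parity (replicate n false) ≡ false
parity-0 n = trans (parity≡isOdd-weight (replicate n false)) (cong isOdd (weight-replicate-false n))

-- Unit vectors and double counting

unit : ∀ {N} → Fin N → Word N
unit {suc N} zero = true ∷ replicate N false
unit (suc i) = false ∷ unit i

unit-last : ∀ n → unit (fromℕ n) ≡ replicate n false ∷ʳ true
unit-last zero = refl
unit-last (suc n) = cong (false ∷_) (unit-last n)

parity-unit : ∀ {N} (i : Fin N) → parity (unit i) ≡ true
parity-unit {suc N} zero = cong not (parity-0 N)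
parity-unit (suc i) = parity-unit i

dist-unit-0 : ∀ {N} (i : Fin N) → dist (unit i) (replicate N false) ≡ 1
dist-unit-0 {suc N} zero = cong suc (dist-0-0 N)
dist-unit-0 (suc i) = dist-unit-0 i

-- v is at distance k from eᵢ iff vᵢ = 1 and wt v = k+1, or vᵢ = 0 and wt v = k−1.
∑-unit-dist : ∀ {N} (v : Word N) (k : ℕ) →
  ∑[ i < N ] 𝟙 (dist (unit i) v ≡ᵇ k)
    ≡ weight v * 𝟙 (weight v ≡ᵇ suc k) + zeros v * 𝟙 (suc (weight v) ≡ᵇ k)
∑-unit-dist [] k = refl
∑-unit-dist {suc N} (true ∷ v) zero rewrite dist-0ˡ v | sum-replicate-zero N | *-zeroʳ (zeros v)
  with weight v
... | zero = refl
... | suc w = sym (cong (_+ 0) (*-zeroʳ (suc (suc w))))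
∑-unit-dist {suc N} (true ∷ v) (suc k) rewrite dist-0ˡ v | ∑-unit-dist v k =
  sym (+-assoc (𝟙 (weight v ≡ᵇ suc k)) _ _)
∑-unit-dist {suc N} (false ∷ v) k rewrite dist-0ˡ v | ∑-unit-dist v k =
  x∙yz≈y∙xz (𝟙 (suc (weight v) ≡ᵇ k)) (weight v * 𝟙 (weight v ≡ᵇ suc k)) _

B-as-Σ : ∀ {N} (D : Code N) (x : Word N) (k : ℕ) →
  B D x k ≡ Σ-word N (λ v → 𝟙 (D v) * 𝟙 (dist x v ≡ᵇ k))
B-as-Σ {N} D x k =
  trans (count≡Σ-word (λ v → D v ∧ (dist x v ≡ᵇ k))) (Σ-word-cong N (λ v → 𝟙-∧ (D v) (dist x v ≡ᵇ k)))

∑-B-unit : ∀ {N} (D : Code N) (m : ℕ) →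
  ∑[ i < N ] B D (unit i) (suc m) ≡ suc (suc m) * A D (suc (suc m)) + (N ∸ m) * A D m
∑-B-unit {N} D m = begin
  ∑[ i < N ] B D (unit i) (suc m)
    ≡⟨ sum-cong-≗ {N} {λ i → B D (unit i) (suc m)} (λ i → B-as-Σ D (unit i) (suc m)) ⟩
  ∑[ i < N ] Σ-word N (λ v → 𝟙 (D v) * 𝟙 (dist (unit i) v ≡ᵇ suc m))
    ≡⟨ ∑-Σ-word-comm N N (λ i v → 𝟙 (D v) * 𝟙 (dist (unit i) v ≡ᵇ suc m)) ⟩
  Σ-word N (λ v → ∑[ i < N ] (𝟙 (D v) * 𝟙 (dist (unit i) v ≡ᵇ suc m)))
    ≡⟨ Σ-word-cong N split ⟩
  Σ-word N (λ v → 𝟙 (D v) * (weight v * 𝟙 (weight v ≡ᵇ suc (suc m)))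
                 + 𝟙 (D v) * ((N ∸ weight v) * 𝟙 (weight v ≡ᵇ m)))
    ≡⟨ Σ-word-+ N _ _ ⟩
  Σ-word N (λ v → 𝟙 (D v) * (weight v * 𝟙 (weight v ≡ᵇ suc (suc m))))
    + Σ-word N (λ v → 𝟙 (D v) * ((N ∸ weight v) * 𝟙 (weight v ≡ᵇ m)))
    ≡⟨ cong₂ _+_ (A-weighted D (λ w → w) (suc (suc m))) (A-weighted D (N ∸_) m) ⟩
  suc (suc m) * A D (suc (suc m)) + (N ∸ m) * A D m ∎
  where
  open ≡-Reasoning
  split : ∀ v → ∑[ i < N ] (𝟙 (D v) * 𝟙 (dist (unit i) v ≡ᵇ suc m))
              ≡ 𝟙 (D v) * (weight v * 𝟙 (weight v ≡ᵇ suc (suc m)))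
                + 𝟙 (D v) * ((N ∸ weight v) * 𝟙 (weight v ≡ᵇ m))
  split v = begin
    ∑[ i < N ] (𝟙 (D v) * 𝟙 (dist (unit i) v ≡ᵇ suc m))
      ≡⟨ *-distribˡ-sum {N} (𝟙 (D v)) (λ i → 𝟙 (dist (unit i) v ≡ᵇ suc m)) ⟨
    𝟙 (D v) * ∑[ i < N ] 𝟙 (dist (unit i) v ≡ᵇ suc m)
      ≡⟨ cong (𝟙 (D v) *_) (∑-unit-dist v (suc m)) ⟩
    𝟙 (D v) * (weight v * 𝟙 (weight v ≡ᵇ suc (suc m)) + zeros v * 𝟙 (weight v ≡ᵇ m))
      ≡⟨ cong (λ z → 𝟙 (D v) * (weight v * 𝟙 (weight v ≡ᵇ suc (suc m)) + z * 𝟙 (weight v ≡ᵇ m)))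
              (zeros≡∸weight v) ⟩
    𝟙 (D v) * (weight v * 𝟙 (weight v ≡ᵇ suc (suc m)) + (N ∸ weight v) * 𝟙 (weight v ≡ᵇ m))
      ≡⟨ *-distribˡ-+ (𝟙 (D v)) _ _ ⟩
    𝟙 (D v) * (weight v * 𝟙 (weight v ≡ᵇ suc (suc m))) + 𝟙 (D v) * ((N ∸ weight v) * 𝟙 (weight v ≡ᵇ m)) ∎

∈-allWords : ∀ {n} (v : Word n) → v ∈ allWords n
∈-allWords [] = here refl
∈-allWords {suc n} (false ∷ v) = ∈-++⁺ˡ (∈-map⁺ (false ∷_) (∈-allWords v))
∈-allWords {suc n} (true ∷ v) = ∈-++⁺ʳ (map (false ∷_) (allWords n)) (∈-map⁺ (true ∷_) (∈-allWords v))

module _ {N : ℕ} (D : Code N) (x : Word N) where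

  private
    nearest : List (Word N) → ℕ
    nearest = foldr (λ v acc → if D v then dist x v ⊓ acc else acc) N

    nearest-≤ : ∀ {v} l → T (D v) → v ∈ l → nearest l ≤ dist x v
    nearest-≤ (u ∷ l) Du (here refl) with D u
    ... | true = m⊓n≤m (dist x u) (nearest l)
    nearest-≤ (u ∷ l) Dv (there v∈l) with D u
    ... | true = ≤-trans (m⊓n≤n (dist x u) (nearest l)) (nearest-≤ l Dv v∈l)
    ... | false = nearest-≤ l Dv v∈l

    ≤-nearest : ∀ {k} l → k ≤ N → (∀ v → T (D v) → k ≤ dist x v) → k ≤ nearest l
    ≤-nearest [] k≤N _ = k≤N
    ≤-nearest (u ∷ l) k≤N k≤dist with D u in Du
    ... | true = ⊓-glb (k≤dist u (subst T (sym Du) _)) (≤-nearest l k≤N k≤dist)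
    ... | false = ≤-nearest l k≤N k≤dist

  distToCode-≤ : ∀ {v} → T (D v) → distToCode D x ≤ dist x v
  distToCode-≤ {v} Dv = nearest-≤ (allWords N) Dv (∈-allWords v)

  ≤-distToCode : ∀ {k} → k ≤ N → (∀ v → T (D v) → k ≤ dist x v) → k ≤ distToCode D x
  ≤-distToCode = ≤-nearest (allWords N)

-- The parity extension

extend-∷ʳ : ∀ {n} (C : Code n) (x : Word n) (b : Bool) → extend C (x ∷ʳ b) ≡ C x ∧ not (b xor parity x)
extend-∷ʳ C x b rewrite init-∷ʳ b x | last-∷ʳ b x = refl

0∈extend : ∀ {n} (C : Code n) → T (C (replicate n false)) → T (extend C (replicate (suc n) false))
0∈extend {n} C 0∈C = subst (λ y → T (extend C y)) (replicate-∷ʳ n) (subst T (sym zero-extends) 0∈C)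
  where
  zero-extends : extend C (replicate n false ∷ʳ false) ≡ C (replicate n false)
  zero-extends rewrite extend-∷ʳ C (replicate n false) false | parity-0 n = ∧-identityʳ _

parity-extend : ∀ {n} (C : Code n) (y : Word (suc n)) → T (extend C y) → parity y ≡ false
parity-extend C y y∈C* = begin
  parity y                    ≡⟨ cong parity (proj₂ (proj₂ (initLast y))) ⟩
  parity (init y ∷ʳ last y)   ≡⟨ parity-∷ʳ (init y) (last y) ⟩
  parity (init y) xor last y  ≡⟨ check-bit (C (init y)) (last y) (parity (init y)) y∈C* ⟩
  false                       ∎
  where
  open ≡-Reasoning
  check-bit : ∀ a b p → T (a ∧ not (b xor p)) → p xor b ≡ false
  check-bit true false false _ = refl
  check-bit true true true _ = refl

parity-check-redundant : ∀ c w k b → isOdd k ≡ b → (c ∧ not (b xor isOdd w)) ∧ (w ≡ᵇ k) ≡ c ∧ (w ≡ᵇ k)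
parity-check-redundant c w k b odd-k with w ≡ᵇ k in w≡k
... | false = trans (∧-zeroʳ _) (sym (∧-zeroʳ c))
... | true rewrite ≡ᵇ⇒≡ w k (subst T (sym w≡k) _) | odd-k | xor-same b = cong (_∧ true) (∧-identityʳ c)

A-extend : ∀ {n} (C : Code n) (j : ℕ) → isOdd j ≡ true → A (extend C) (suc j) ≡ A C (suc j) + A C j
A-extend C j odd-j =
  trans (count-∷ʳ (λ y → extend C y ∧ (weight y ≡ᵇ suc j)))
        (cong₂ _+_ (count-cong last-bit-0) (count-cong last-bit-1))
  where
  last-bit-0 : ∀ x → extend C (x ∷ʳ false) ∧ (weight (x ∷ʳ false) ≡ᵇ suc j) ≡ C x ∧ (weight x ≡ᵇ suc j)
  last-bit-0 x rewrite extend-∷ʳ C x false | weight-∷ʳ x false | parity≡isOdd-weight x =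
    parity-check-redundant (C x) (weight x) (suc j) false (cong not odd-j)
  last-bit-1 : ∀ x → extend C (x ∷ʳ true) ∧ (weight (x ∷ʳ true) ≡ᵇ suc j) ≡ C x ∧ (weight x ≡ᵇ j)
  last-bit-1 x rewrite extend-∷ʳ C x true | weight-∷ʳ x true | parity≡isOdd-weight x =
    parity-check-redundant (C x) (weight x) j true odd-j

B-extend-last : ∀ {n} (C : Code n) (m : ℕ) → isOdd m ≡ false →
  B (extend C) (replicate n false ∷ʳ true) (suc m) ≡ A C m + A C (suc m)
B-extend-last {n} C m even-m =
  trans (count-∷ʳ (λ y → extend C y ∧ (dist r y ≡ᵇ suc m)))
        (cong₂ _+_ (count-cong last-bit-0) (count-cong last-bit-1))
  where
  r = replicate n false ∷ʳ true
  last-bit-0 : ∀ x → extend C (x ∷ʳ false) ∧ (dist r (x ∷ʳ false) ≡ᵇ suc m) ≡ C x ∧ (weight x ≡ᵇ m)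
  last-bit-0 x rewrite extend-∷ʳ C x false | dist-∷ʳ (replicate n false) x true false
                     | dist-0ˡ x | parity≡isOdd-weight x =
    parity-check-redundant (C x) (weight x) m false even-m
  last-bit-1 : ∀ x → extend C (x ∷ʳ true) ∧ (dist r (x ∷ʳ true) ≡ᵇ suc m) ≡ C x ∧ (weight x ≡ᵇ suc m)
  last-bit-1 x rewrite extend-∷ʳ C x true | dist-∷ʳ (replicate n false) x true true
                     | dist-0ˡ x | parity≡isOdd-weight x =
    parity-check-redundant (C x) (weight x) (suc m) true (cong not even-m)

A-above-length : ∀ {n} (C : Code n) {k} → n < k → A C k ≡ 0
A-above-length C {k} n<k = A≡0 C k (λ x _ w≡k → <⇒≱ n<k (subst (_≤ _) w≡k (weight≤length x)))

A-below-minDistance : ∀ {n δ} (C : Code n) → T (C (replicate n false)) → MinDistance (extend C) δ →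
  ∀ k → 0 < k → suc k < δ → A C k ≡ 0
A-below-minDistance {n} {δ} C 0∈C (separated , _) k 0<k sk<δ = A≡0 C k excluded
  where
  excluded : ∀ x → T (C x) → weight x ≢ k
  excluded x x∈C w≡k = <⇒≱ sk<δ (≤-trans (separated 0* x* (0∈extend C 0∈C) x*∈C* 0≢x*) dist≤)
    where
    0* x* : Word (suc n)
    0* = replicate (suc n) false
    x* = x ∷ʳ parity x
    x*∈C* : T (extend C x*)
    x*∈C* = subst T (sym (begin
      extend C x*                                ≡⟨ extend-∷ʳ C x (parity x) ⟩
      C x ∧ not (parity x xor parity x)          ≡⟨ cong (λ b → C x ∧ not b) (xor-same (parity x)) ⟩
      C x ∧ true                                 ≡⟨ ∧-identityʳ (C x) ⟩
      C x                                        ∎)) x∈C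
      where open ≡-Reasoning
    dist≡ : dist 0* x* ≡ 𝟙 (parity x) + k
    dist≡ = trans (dist-0ˡ x*) (trans (weight-∷ʳ x (parity x)) (cong (𝟙 (parity x) +_) w≡k))
    dist≤ : dist 0* x* ≤ suc k
    dist≤ = subst (_≤ suc k) (sym dist≡) (+-monoˡ-≤ k (𝟙≤1 (parity x)))
    0≢x* : 0* ≢ x*
    0≢x* 0≡x* = <⇒≱ 0<k (begin
      k                 ≤⟨ m≤n+m k (𝟙 (parity x)) ⟩
      𝟙 (parity x) + k  ≡⟨ dist≡ ⟨
      dist 0* x*        ≡⟨ cong (dist 0*) 0≡x* ⟨
      dist 0* 0*        ≡⟨ dist-0-0 (suc n) ⟩
      0                 ∎)
      where open ≤-Reasoning

-- The recurrence

-- The first hypothesis covers truncated subtraction: (n ∸ h) + (h + 1) = n + 1 fails for h ≥ n.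
recurrence-step : ∀ n h {a₀ a₁ a₂ a₃ : ℕ} → (n ≤ h → a₁ ≡ 0)
  → suc n * (a₁ + a₂) ≡ suc (suc (suc h)) * (a₃ + a₂) + (n ∸ h) * (a₁ + a₀)
  → (n ∸ h) * a₀ ≡ suc h * a₁
  → (n ∸ suc (suc h)) * a₂ ≡ suc (suc (suc h)) * a₃
recurrence-step n h {a₀} {a₁} {a₂} {a₃} a₁-vanishes identity hyp = begin
  (n ∸ suc (suc h)) * a₂                 ≡⟨ *-distribʳ-∸ a₂ (suc n) c ⟩
  suc n * a₂ ∸ c * a₂                    ≡⟨ cong (_∸ c * a₂) cancelled ⟩
  c * a₃ + c * a₂ ∸ c * a₂               ≡⟨ m+n∸n≡m (c * a₃) (c * a₂) ⟩
  c * a₃                                 ∎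
  where
  open ≡-Reasoning
  c = suc (suc (suc h))
  coefficient : ((n ∸ h) + suc h) * a₁ ≡ suc n * a₁
  coefficient with n ≤? h
  ... | yes n≤h rewrite a₁-vanishes n≤h = trans (*-zeroʳ ((n ∸ h) + suc h)) (sym (*-zeroʳ (suc n)))
  ... | no n≰h = cong (_* a₁) (trans (+-suc (n ∸ h) h) (cong suc (m∸n+n≡m (≰⇒≥ n≰h))))
  absorbed : (n ∸ h) * (a₁ + a₀) ≡ suc n * a₁
  absorbed = begin
    (n ∸ h) * (a₁ + a₀)           ≡⟨ *-distribˡ-+ (n ∸ h) a₁ a₀ ⟩
    (n ∸ h) * a₁ + (n ∸ h) * a₀   ≡⟨ cong ((n ∸ h) * a₁ +_) hyp ⟩
    (n ∸ h) * a₁ + suc h * a₁     ≡⟨ *-distribʳ-+ a₁ (n ∸ h) (suc h) ⟨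
    ((n ∸ h) + suc h) * a₁        ≡⟨ coefficient ⟩
    suc n * a₁                    ∎
  cancelled : suc n * a₂ ≡ c * a₃ + c * a₂
  cancelled = +-cancelˡ-≡ (suc n * a₁) _ _ (begin
    suc n * a₁ + suc n * a₂              ≡⟨ *-distribˡ-+ (suc n) a₁ a₂ ⟨
    suc n * (a₁ + a₂)                    ≡⟨ identity ⟩
    c * (a₃ + a₂) + (n ∸ h) * (a₁ + a₀)  ≡⟨ cong (c * (a₃ + a₂) +_) absorbed ⟩
    c * (a₃ + a₂) + suc n * a₁           ≡⟨ +-comm (c * (a₃ + a₂)) (suc n * a₁) ⟩
    suc n * a₁ + c * (a₃ + a₂)           ≡⟨ cong (suc n * a₁ +_) (*-distribˡ-+ c a₃ a₂) ⟩
    suc n * a₁ + (c * a₃ + c * a₂)       ∎)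

WeightRecurrence : ∀ {n} → Code n → ℕ → Set
WeightRecurrence {n} C w = (n ∸ w) * A C w ≡ suc w * A C (suc w)

module _ {n : ℕ} (C : Code n) (0∈C : T (C (replicate n false))) where

  dist-unit-codeword≢0 : ∀ i v → T (extend C v) → dist (unit i) v ≢ 0
  dist-unit-codeword≢0 i v v∈C* d≡0
    with trans (sym (parity-unit i)) (trans (cong parity (dist≡0⇒≡ (unit i) v d≡0)) (parity-extend C v v∈C*))
  ... | ()

  distToCode-unit : ∀ i → distToCode (extend C) (unit i) ≡ 1
  distToCode-unit i = ≤-antisym
    (subst (distToCode (extend C) (unit i) ≤_) (dist-unit-0 i) (distToCode-≤ (extend C) (unit i) (0∈extend C 0∈C)))
    (≤-distToCode (extend C) (unit i) (s≤s z≤n) (λ v v∈C* → n≢0⇒n>0 (dist-unit-codeword≢0 i v v∈C*)))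

  weight-recurrence-base : ∀ e → MinDistance (extend C) (2 * suc e + 2) → WeightRecurrence C (suc (e * 2))
  weight-recurrence-base e minDist = begin
    (n ∸ suc (e * 2)) * A C (suc (e * 2))  ≡⟨ cong ((n ∸ suc (e * 2)) *_) (vanishes (suc (e * 2)) (s≤s z≤n) (n≤1+n _)) ⟩
    (n ∸ suc (e * 2)) * 0                  ≡⟨ *-zeroʳ (n ∸ suc (e * 2)) ⟩
    0                                      ≡⟨ *-zeroʳ (2 + e * 2) ⟨
    (2 + e * 2) * 0                        ≡⟨ cong ((2 + e * 2) *_) (vanishes (2 + e * 2) (s≤s z≤n) ≤-refl) ⟨
    (2 + e * 2) * A C (2 + e * 2)          ∎
    where
    open ≡-Reasoning
    δ≡ : 2 * suc e + 2 ≡ 4 + e * 2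
    δ≡ = trans (cong (_+ 2) (*-comm 2 (suc e))) (+-comm (2 + e * 2) 2)
    vanishes : ∀ k → 0 < k → suc (suc k) ≤ 4 + e * 2 → A C k ≡ 0
    vanishes k 0<k sk<δ = A-below-minDistance C 0∈C minDist k 0<k (subst (suc (suc k) ≤_) (sym δ≡) sk<δ)

module _ {n : ℕ} (C : Code n) (0∈C : T (C (replicate n false))) (CR : CompletelyRegular (extend C)) where

  private
    C* : Code (suc n)
    C* = extend C

  B-unit≡B-last : ∀ i k → B C* (unit i) k ≡ B C* (replicate n false ∷ʳ true) k
  B-unit≡B-last i k = subst (λ y → B C* (unit i) k ≡ B C* y k) (unit-last n)
    (CR (unit i) (unit (fromℕ n)) (trans (distToCode-unit C 0∈C i) (sym (distToCode-unit C 0∈C (fromℕ n)))) k)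

  weight-identity : ∀ h → isOdd h ≡ true →
    suc n * (A C (suc h) + A C (suc (suc h)))
      ≡ suc (suc (suc h)) * (A C (suc (suc (suc h))) + A C (suc (suc h))) + (n ∸ h) * (A C (suc h) + A C h)
  weight-identity h odd-h = begin
    suc n * (A C (suc h) + A C (suc (suc h)))
      ≡⟨ cong (suc n *_) (B-extend-last C (suc h) (cong not odd-h)) ⟨
    suc n * B C* r (suc (suc h))
      ≡⟨ ∑-const (suc n) _ ⟨
    ∑[ i < suc n ] B C* r (suc (suc h))
      ≡⟨ sum-cong-≗ {suc n} {λ i → B C* (unit i) (suc (suc h))} (λ i → B-unit≡B-last i (suc (suc h))) ⟨
    ∑[ i < suc n ] B C* (unit i) (suc (suc h))
      ≡⟨ ∑-B-unit C* (suc h) ⟩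
    suc (suc (suc h)) * A C* (suc (suc (suc h))) + (n ∸ h) * A C* (suc h)
      ≡⟨ cong₂ (λ a b → suc (suc (suc h)) * a + (n ∸ h) * b)
               (A-extend C (suc (suc h)) (trans (not-involutive _) odd-h)) (A-extend C h odd-h) ⟩
    suc (suc (suc h)) * (A C (suc (suc (suc h))) + A C (suc (suc h))) + (n ∸ h) * (A C (suc h) + A C h) ∎
    where
    open ≡-Reasoning
    r = replicate n false ∷ʳ true

  weight-recurrence-+2 : ∀ h → isOdd h ≡ true → WeightRecurrence C h → WeightRecurrence C (suc (suc h))
  weight-recurrence-+2 h odd-h =
    recurrence-step n h {a₃ = A C (suc (suc (suc h)))}
      (λ n≤h → A-above-length C (s≤s n≤h)) (weight-identity h odd-h)

  weight-recurrence-odd : ∀ {e k} → e ≤′ k →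
    WeightRecurrence C (suc (e * 2)) → WeightRecurrence C (suc (k * 2))
  weight-recurrence-odd ≤′-refl base = base
  weight-recurrence-odd {k = suc k} (≤′-step e≤k) base =
    weight-recurrence-+2 (suc (k * 2)) (isOdd-2k+1 k) (weight-recurrence-odd e≤k base)

mainTheorem4 : (n e : ℕ) (C : Code n) → T (C (replicate n false)) → DistanceInvariant C
    → CompletelyRegular (extend C) → MinDistance (extend C) (2 * e + 2) → 1 ≤ e
    → (w : ℕ) → w % 2 ≡ 1 → 2 * e + 1 ≤ w
    → (n ∸ w) * A C w ≡ (w + 1) * A C (w + 1)
mainTheorem4 n (suc e) C 0∈C _ CR minDist _ w w-odd 2e+1≤w =
  subst (λ v → (n ∸ v) * A C v ≡ (v + 1) * A C (v + 1)) (sym w≡2q+1)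
    (subst (λ v → (n ∸ suc (q * 2)) * A C (suc (q * 2)) ≡ v * A C v) (+-comm 1 (suc (q * 2)))
      (weight-recurrence-odd C 0∈C CR (≤⇒≤′ e≤q) (weight-recurrence-base C 0∈C e minDist)))
  where
  q = w / 2
  w≡2q+1 : w ≡ suc (q * 2)
  w≡2q+1 = trans (m≡m%n+[m/n]*n w 2) (cong (_+ q * 2) w-odd)
  e≤q : e ≤ q
  e≤q = <⇒≤ (*-cancelʳ-≤ (suc e) q 2 (subst (_≤ q * 2) (*-comm 2 (suc e))
          (≤-pred (subst₂ _≤_ (+-comm (2 * suc e) 1) w≡2q+1 2e+1≤w))))
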